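{- Let $\mathcal O$ be the DL-Lite ontology $\{A\sqsubseteq\exists R,\ \exists R^-\sqsubseteq A\}$ for a concept name $A$ and role name $R$. Then $\mathcal{L}(\exists,-,\sqcap)$ does not admit finite characterisations under $\mathcal O$.
   Context: $\mathcal{L}(\exists,-,\sqcap)[\Sigma_C,\Sigma_R]$ is the set of concepts $C ::= B\mid C\sqcap C\mid\exists S.C$ with $B$ in a finite set $\Sigma_C$ of concept names and $S$ either a role name in a finite set $\Sigma_R$ or its inverse $R'^-$, where $(R'^-)^{\mathcal I}$ is the converse of $R'^{\mathcal I}$; standard semantics. $\exists S$ abbreviates $\exists S.\top$; $\mathcal I\models\mathcal O$ if $A^{\mathcal I}\subseteq(\exists R)^{\mathcal I}$ and $(\exists R^-)^{\mathcal I}\subseteq A^{\mathcal I}$. $C\equiv_{\mathcal O}D$ if $C^{\mathcal I}=D^{\mathcal I}$ for all $\mathcal I\models\mathcal O$. An example for $\mathcal O$ is a finite pointed interpretation $(\mathcal I,d)$ with $\mathcal I\models\mathcal O$, labelled positive or negative; $C$ fits $E=(E^+,E^-)$ if $d\in C^{\mathcal I}$ for positive and $d\notin C^{\mathcal I}$ for negative examples. A finite characterisation of $C$ w.r.t. $\mathcal L$ under $\mathcal O$ is a finite collection $E$ of examples for $\mathcal O$ that $C$ fits such that every $D\in\mathcal L$ fitting $E$ satisfies $C\equiv_{\mathcal O}D$. $\mathcal L$ admits finite characterisations under $\mathcal O$ if for all finite $\Sigma_C,\Sigma_R$, every $C\in\mathcal L[\Sigma_C,\Sigma_R]$ has such a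 characterisation w.r.t. $\mathcal L[\Sigma_C,\Sigma_R]$ under $\mathcal O$. -}

module Defs where

open import Data.Nat using (ℕ)
open import Data.Fin using (Fin)
open import Data.List using (List)
open import Data.List.Membership.Propositional using (_∈_)
open import Data.List.Relation.Unary.All using (All)
open import Data.Product using (Σ; ∃; _×_; _,_)
open import Relation.Nullary using (¬_)
open import Function.Bundles using (_⇔_)

ConceptName : Set
ConceptName = ℕ

RoleName : Set
RoleName = ℕ

data Role : Set where
  rn  : RoleName → Role
  inv : RoleName → Role

data Concept : Set where
  atom : ConceptName → Concept
  _⊓_  : Concept → Concept → Concept
  ex   : Role → Concept → Concept

data InSig (ΣC : List ConceptName) (ΣR : List RoleName) : Concept → Set where
  atom : ∀ {B} → B ∈ ΣC → InSig ΣC ΣR (atom B)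
  _⊓_  : ∀ {C D} → InSig ΣC ΣR C → InSig ΣC ΣR D → InSig ΣC ΣR (C ⊓ D)
  exR  : ∀ {r C} → r ∈ ΣR → InSig ΣC ΣR C → InSig ΣC ΣR (ex (rn r) C)
  exI  : ∀ {r C} → r ∈ ΣR → InSig ΣC ΣR C → InSig ΣC ΣR (ex (inv r) C)

record Interp : Set₁ where
  field
    Δ    : Set
    conc : ConceptName → Δ → Set
    role : RoleName → Δ → Δ → Set

open Interp public

roleI : (I : Interp) → Role → Δ I → Δ I → Set
roleI I (rn r)  x y = role I r x y
roleI I (inv r) x y = role I r y x

⟦_⟧ : Concept → (I : Interp) → Δ I → Set
⟦ atom B ⟧ I x = conc I B x
⟦ C ⊓ D ⟧ I x = ⟦ C ⟧ I x × ⟦ D ⟧ I x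
⟦ ex S C ⟧ I x = Σ (Δ I) λ y → roleI I S x y × ⟦ C ⟧ I y

-- I ⊨ O  for  O = { A ⊑ ∃R , ∃R⁻ ⊑ A }  (∃S abbreviates ∃S.⊤)
ModelO : ConceptName → RoleName → Interp → Set
ModelO a r I =
  (∀ x → conc I a x → Σ (Δ I) λ y → role I r x y)
  × (∀ x → (Σ (Δ I) λ y → role I r y x) → conc I a x)

EquivO : ConceptName → RoleName → Concept → Concept → Set₁
EquivO a r C D = ∀ (I : Interp) → ModelO a r I → ∀ x → (⟦ C ⟧ I x ⇔ ⟦ D ⟧ I x)

finInterp : (n : ℕ) → (ConceptName → Fin n → Set) → (RoleName → Fin n → Fin n → Set) → Interp
finInterp n c ro = record { Δ = Fin n ; conc = c ; role = ro }

record Example (a : ConceptName) (r : RoleName) : Set₁ where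
  field
    size  : ℕ
    cI    : ConceptName → Fin size → Set
    rI    : RoleName → Fin size → Fin size → Set
    point : Fin size
    model : ModelO a r (finInterp size cI rI)

open Example public

exInterp : ∀ {a r} → Example a r → Interp
exInterp e = finInterp (size e) (cI e) (rI e)

Examples : ConceptName → RoleName → Set₁
Examples a r = List (Example a r) × List (Example a r)

Fits : ∀ {a r} → Concept → Examples a r → Set₁
Fits C (pos , neg) =
  All (λ e → ⟦ C ⟧ (exInterp e) (point e)) pos
  × All (λ e → ¬ ⟦ C ⟧ (exInterp e) (point e)) neg

FiniteCharacterisation : (a : ConceptName) (r : RoleName)
  (ΣC : List ConceptName) (ΣR : List RoleName) → Concept → Examples a r → Set₁
FiniteCharacterisation a r ΣC ΣR C E =
  Fits C E × (∀ D → InSig ΣC ΣR D → Fits D E → EquivO a r C D)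

AdmitsFiniteCharacterisations : ConceptName → RoleName → Set₁
AdmitsFiniteCharacterisations a r =
  ∀ (ΣC : List ConceptName) (ΣR : List RoleName) (C : Concept) → InSig ΣC ΣR C →
    Σ (Examples a r) λ E → FiniteCharacterisation a r ΣC ΣR C E

module Submission where

open import Defs
open import Relation.Nullary using (¬_)
open import Data.Nat using (ℕ; zero; suc; _+_; _≤_; _<_; z≤n; s≤s)
open import Data.Nat.Properties using (≤-refl; ≤-trans; <⇒≤; n≮n; +-identityʳ; +-suc; m≤n⇒m<n∨m≡n)
open import Data.Fin using (Fin; toℕ)
open import Data.Fin.Properties using (pigeonhole; toℕ≤pred[n])
open import Data.List using ([]; _∷_; map)
open import Data.List.Extrema.Nat using (max; xs≤max)
import Data.List.Relation.Unary.All as All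
open import Data.List.Relation.Unary.All.Properties using (map⁻)
open import Data.List.Relation.Unary.Any using (here)
open import Data.Product using (Σ; ∃₂; _×_; _,_; proj₁; proj₂)
open import Data.Sum using (inj₁; inj₂)
open import Data.Unit using (⊤; tt)
open import Function using (_∘_)
open import Function.Bundles using (Equivalence)
open import Relation.Binary.PropositionalEquality using (_≡_; refl; sym; subst)

-- The concept A has no finite characterisation. In a model of O every A-element starts an infinite R-path through A,
-- which in a finite model must run into a cycle; around that cycle R⁻-paths of any length
-- exist. Hence every finite positive example also satisfies
--   D_N = A ⊓ ∃R^N.(∃R⁻)^(N+1).A
-- once N bounds the sizes of the positive examples, and D_N fails on every negative example
-- since A does. But D_N ≢_O A: in the model ℕ with R the successor relation, an R⁻-path of
-- length N+1 cannot start at N.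

ex^ : Role → ℕ → Concept → Concept
ex^ S zero    C = C
ex^ S (suc k) C = ex S (ex^ S k C)

ex^-inSig : ∀ {ΣC ΣR S C} → (∀ {D} → InSig ΣC ΣR D → InSig ΣC ΣR (ex S D)) →
            ∀ k → InSig ΣC ΣR C → InSig ΣC ΣR (ex^ S k C)
ex^-inSig ex-inSig zero    C∈ = C∈
ex^-inSig ex-inSig (suc k) C∈ = ex-inSig (ex^-inSig ex-inSig k C∈)

IsChain : (I : Interp) → Role → (ℕ → Δ I) → Set
IsChain I S f = ∀ t → roleI I S (f t) (f (suc t))

chain⇒ex^ : ∀ I {S C} (f : ℕ → Δ I) → IsChain I S f →
            ∀ k → ⟦ C ⟧ I (f k) → ⟦ ex^ S k C ⟧ I (f 0)
chain⇒ex^ I f chain zero    h = h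
chain⇒ex^ I f chain (suc k) h = f 1 , chain 0 , chain⇒ex^ I (f ∘ suc) (chain ∘ suc) k h

-- From position i on, an R-chain with f i ≡ f (suc j) can be walked backwards forever:
-- at position i itself the predecessor is taken to be f j.
lasso⇒ex⁻^ : ∀ I r {C} (f : ℕ → Δ I) → IsChain I (rn r) f → (∀ t → ⟦ C ⟧ I (f t)) →
             ∀ {i j} → f i ≡ f (suc j) → i ≤ j →
             ∀ M {p} → i ≤ p → ⟦ ex^ (inv r) M C ⟧ I (f p)
lasso⇒ex⁻^ I r f chain C-everywhere loop i≤j zero {p} i≤p = C-everywhere p
lasso⇒ex⁻^ I r f chain C-everywhere {j = j} loop i≤j (suc M) i≤p with m≤n⇒m<n∨m≡n i≤p
... | inj₁ (s≤s {n = p} i≤p) =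
  f p , chain p , lasso⇒ex⁻^ I r f chain C-everywhere loop i≤j M i≤p
... | inj₂ refl =
  f j , subst (role I r (f j)) (sym loop) (chain j) , lasso⇒ex⁻^ I r f chain C-everywhere loop i≤j M i≤j

ℕ→Fin-repeats : ∀ {n} (f : ℕ → Fin n) → ∃₂ λ i j → i ≤ j × j < n × f i ≡ f (suc j)
ℕ→Fin-repeats {n} f with pigeonhole ≤-refl (f ∘ toℕ {suc n})
... | i , j , i<j , fi≡fj = repeat i<j (toℕ≤pred[n] j) fi≡fj
  where
  repeat : ∀ {i k} → i < k → k ≤ n → f i ≡ f k → ∃₂ λ i j → i ≤ j × j < n × f i ≡ f (suc j)
  repeat {i} {suc j} (s≤s i≤j) j<n fi≡fj = i , j , i≤j , j<n , fi≡fj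

successorInterp : Interp
successorInterp = record { Δ = ℕ ; conc = λ _ _ → ⊤ ; role = λ _ x y → y ≡ suc x }

module _ (a : ConceptName) (r : RoleName) where

  lassoConcept : ℕ → Concept
  lassoConcept N = atom a ⊓ ex^ (rn r) N (ex^ (inv r) (suc N) (atom a))

  lassoConcept-inSig : ∀ N → InSig (a ∷ []) (r ∷ []) (lassoConcept N)
  lassoConcept-inSig N =
    A∈ ⊓ ex^-inSig (exR (here refl)) N (ex^-inSig (exI (here refl)) (suc N) A∈)
    where
    A∈ : InSig (a ∷ []) (r ∷ []) (atom a)
    A∈ = atom (here refl)

  module _ (I : Interp) (⊨O : ModelO a r I) where

    A-successor : Σ (Δ I) (conc I a) → Σ (Δ I) (conc I a)
    A-successor (x , xA) = let (y , xRy) = proj₁ ⊨O x xA in y , proj₂ ⊨O y (x , xRy)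

    A-chain : Σ (Δ I) (conc I a) → ℕ → Σ (Δ I) (conc I a)
    A-chain x zero    = x
    A-chain x (suc t) = A-successor (A-chain x t)

    A-chain-isChain : ∀ x → IsChain I (rn r) (proj₁ ∘ A-chain x)
    A-chain-isChain x t = proj₂ (proj₁ ⊨O _ (proj₂ (A-chain x t)))

  finite-A⇒lassoConcept : ∀ N {e : Example a r} →
    conc (exInterp e) a (point e) × size e ≤ N → ⟦ lassoConcept N ⟧ (exInterp e) (point e)
  finite-A⇒lassoConcept N {e} (xA , size≤N) =
    let i , j , i≤j , j<size , loop = ℕ→Fin-repeats f
    in xA , chain⇒ex^ I f chain N
              (lasso⇒ex⁻^ I r f chain (proj₂ ∘ path) loop i≤j
                 (suc N) (≤-trans i≤j (<⇒≤ (≤-trans j<size size≤N))))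
    where
    I : Interp
    I = exInterp e
    path : ℕ → Σ (Δ I) (conc I a)
    path = A-chain I (model e) (point e , xA)
    f : ℕ → Δ I
    f = proj₁ ∘ path
    chain : IsChain I (rn r) f
    chain = A-chain-isChain I (model e) (point e , xA)

  successor-⊨O : ModelO a r successorInterp
  successor-⊨O = (λ x _ → suc x , refl) , (λ _ _ → tt)

  successor-ex^ : ∀ {C} k x → ⟦ ex^ (rn r) k C ⟧ successorInterp x → ⟦ C ⟧ successorInterp (x + k)
  successor-ex^ {C} zero    x h = subst (⟦ C ⟧ successorInterp) (sym (+-identityʳ x)) h
  successor-ex^ {C} (suc k) x (_ , refl , h) =
    subst (⟦ C ⟧ successorInterp) (sym (+-suc x k)) (successor-ex^ k (suc x) h)

  successor-ex⁻^ : ∀ {C} M x → ⟦ ex^ (inv r) M C ⟧ successorInterp x → M ≤ x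
  successor-ex⁻^ zero    x       h                = z≤n
  successor-ex⁻^ (suc M) .(suc y) (y , refl , h) = s≤s (successor-ex⁻^ M y h)

  successor-⊭lassoConcept : ∀ N → ¬ ⟦ lassoConcept N ⟧ successorInterp 0
  successor-⊭lassoConcept N (_ , h) = n≮n N (successor-ex⁻^ (suc N) N (successor-ex^ N 0 h))

theorem16 : (a : ConceptName) (r : RoleName) → ¬ AdmitsFiniteCharacterisations a r
theorem16 a r admits with admits (a ∷ []) (r ∷ []) (atom a) (atom (here refl))
... | (pos , neg) , (A-fits-pos , A-fits-neg) , characterises =
  successor-⊭lassoConcept a r N (Equivalence.to (A≡D successorInterp (successor-⊨O a r) 0) tt)
  where
  N : ℕ
  N = max 0 (map size pos)
  size≤N : All.All (λ e → size e ≤ N) pos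
  size≤N = map⁻ (xs≤max 0 (map size pos))
  D-fits : Fits (lassoConcept a r N) (pos , neg)
  D-fits = All.zipWith (λ {e} → finite-A⇒lassoConcept a r N {e}) (A-fits-pos , size≤N)
         , All.map (λ ¬A → ¬A ∘ proj₁) A-fits-neg
  A≡D : EquivO a r (atom a) (lassoConcept a r N)
  A≡D = characterises (lassoConcept a r N) (lassoConcept-inSig a r N) D-fits
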